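{- Let $H$ be a graph, $G$ a graph and $U,W\subseteq V(G)$. If $W$ is a clique of size at least $v(H)-1$ in the final graph of the $H$-process on $G$, and every vertex in $U$ has at least $\delta(H)-1$ neighbours (in $G$) in $W$, then $U\cup W$ is also a clique in the final graph of the $H$-process on $G$.
   Context: For graphs $H,G$, the $H$-process on $G$ is $(G_i)_{i\ge0}$ with $G_0=G$ and $G_i$ obtained from $G_{i-1}$ by adding (simultaneously) every non-edge $e$ on $V(G)$ such that $G_{i-1}+e$ contains more copies of $H$ than $G_{i-1}$. The final graph is $G_t$ for the least $t$ with $G_t=G_{t+1}$. $\delta(H)$ is the minimum degree of $H$.
   Formalization: The graph $H$ is also assumed to have minimum degree $\delta(H)\ge 1$, so $H$ has no isolated vertices. The paper assumes this as well. -}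

module Defs where

open import Data.Nat using (ℕ; suc; _<_; _⊓_)
open import Data.Bool using (Bool; true; false)
open import Data.Fin using (Fin)
open import Data.Fin.Subset using (Subset; _∈_; ∣_∣)
open import Data.Vec using (tabulate)
open import Data.List using (foldr; map; allFin)
open import Data.Product using (Σ; ∃; _×_)
open import Data.Sum using (_⊎_)
open import Function.Definitions using (Injective)
open import Relation.Nullary using (¬_)
open import Relation.Binary.PropositionalEquality using (_≡_; _≢_)

record Graph : Set where
  field
    n      : ℕ
    adj    : Fin n → Fin n → Bool
    sym    : ∀ u v → adj u v ≡ adj v u
    irrefl : ∀ v → adj v v ≡ false
open Graph public

v : Graph → ℕ
v H = n H

nbhd : (G : Graph) → Fin (n G) → Subset (n G)
nbhd G u = tabulate (adj G u)

degree : (G : Graph) → Fin (n G) → ℕ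
degree G u = ∣ nbhd G u ∣

-- δ(H): minimum degree (0 for the empty graph; the initial value n H
-- exceeds every degree, so it is the true minimum when n H > 0).
δ : Graph → ℕ
δ H = foldr _⊓_ (n H) (map (degree H) (allFin (n H)))

-- Graphs on a fixed vertex set Fin m, as (possibly undecidable) edge relations.
Rel : ℕ → Set₁
Rel m = Fin m → Fin m → Set

addEdge : ∀ {m} → Rel m → Fin m → Fin m → Rel m
addEdge E a b x y = E x y ⊎ ((x ≡ a × y ≡ b) ⊎ (x ≡ b × y ≡ a))

-- φ : V(H) → V(G) injective witnesses a copy of H in E (image subgraph).
IsCopy : (H : Graph) → ∀ {m} → Rel m → (Fin (n H) → Fin m) → Set
IsCopy H E φ = Injective _≡_ _≡_ φ × (∀ x y → adj H x y ≡ true → E (φ x) (φ y))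

-- E + ab contains more copies of H than E: since every copy in E is a copy
-- in E + ab, this means some copy of H in E + ab is not a copy in E.
MoreCopies : (H : Graph) → ∀ {m} → Rel m → Fin m → Fin m → Set
MoreCopies H {m} E a b =
  ∃ λ (φ : Fin (n H) → Fin m) → IsCopy H (addEdge E a b) φ × ¬ IsCopy H E φ

step : (H : Graph) → ∀ {m} → Rel m → Rel m
step H E a b = E a b ⊎ (a ≢ b × ¬ E a b × MoreCopies H E a b)

process : (H G : Graph) → ℕ → Rel (n G)
process H G 0       = λ a b → adj G a b ≡ true
process H G (suc i) = step H (process H G i)

SameGraph : ∀ {m} → Rel m → Rel m → Set
SameGraph E F = ∀ a b → (E a b → F a b) × (F a b → E a b)

-- t is the least index with G_t = G_{t+1}; the final graph is then G_t.
IsFinalTime : (H G : Graph) → ℕ → Set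
IsFinalTime H G t =
  SameGraph (process H G t) (process H G (suc t)) ×
  (∀ s → s < t → ¬ SameGraph (process H G s) (process H G (suc s)))

IsClique : ∀ {m} → Rel m → Subset m → Set
IsClique E S = ∀ a b → a ∈ S → b ∈ S → a ≢ b → E a b

{-# OPTIONS --safe #-}
-- Let F be the final graph, K a clique of F with |K| ≥ v(H) − 1, a ∉ K a vertex with a set N ⊆ K
-- of δ(H) − 1 neighbours in F, and b ∈ K ∖ N. Pick x of minimum degree in H and a neighbour y of
-- x, and send x ↦ a, y ↦ b, the other neighbours of x injectively into N and the remaining
-- vertices injectively into K. This is a copy of H in F + ab that uses ab, so ab ∈ F as F is
-- stable. With K = W this joins each u ∈ U to W; with K = W ∪ {u′} and N = W it joins u to u′.
module Submission where

open import Defs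
open import Data.Nat using (ℕ; _≤_; _∸_)
open import Data.Fin.Subset using (Subset; _∈_; ∣_∣; _∩_; _∪_)

open import Data.Bool using (true; false)
import Data.Bool.Properties as Bool
open import Data.Fin using (Fin; zero; suc; _≟_; fromℕ<)
open import Data.Fin.Properties using (any?; all?)
open import Data.Fin.Subset using (_∉_; _⊆_; _─_; _-_; ⁅_⁆; ∁; ⊥; inside; outside; Nonempty)
open import Data.Fin.Subset.Properties
  using (_∈?_; nonempty?; Empty-unique; ∉⊥; ∣⊥∣≡0; ∣⁅x⁆∣≡1; ∣p∣≤n; ∣∁p∣≡n∸∣p∣; ∣p∩q∣≤∣p∣;
         p⊆q⇒∣p∣≤∣q∣; x∈p⇒∣p-x∣<∣p∣; ∣q∣≤∣p∪q∣; x∈⁅x⁆; x∈⁅y⁆⇒x≡y; x∈p∪q⁺; x∈p∪q⁻; x∈p∩q⁻;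
         x∈p∧x∉q⇒x∈p─q; x∈p∧x≢y⇒x∈p-y; x≢y⇒x∉⁅y⁆; p─q⊆p; x∉p⇒x∈∁p)
open import Data.List using (allFin; map)
open import Data.List.Membership.Propositional.Properties
  using (foldr-selective; ∈-map⁺; ∈-map⁻; ∈-allFin)
open import Data.List.Properties using (foldr-forcesᵇ)
import Data.List.Relation.Unary.All as All
open import Data.Nat using (zero; suc; _+_; _<_; z≤n; s≤s)
open import Data.Nat.Properties
  using (≤-refl; ≤-trans; ≤-reflexive; ≤-pred; m≤n⇒m≤1+n; m≤n+m∸n; m∸n+n≡m; +-suc; +-comm;
         +-monoˡ-≤; +-monoʳ-≤; +-cancelʳ-≤; ⊓-sel; m≤n⊓o⇒m≤n; m≤n⊓o⇒m≤o; module ≤-Reasoning)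
open import Data.Product using (∃; _×_; _,_; proj₁; proj₂)
open import Data.Sum using (inj₁; inj₂; [_,_]′)
open import Data.Vec using ([]; _∷_; here; there; tabulate)
open import Data.Vec.Properties using (lookup∘tabulate; []=⇒lookup; lookup⇒[]=)
import Data.Vec.Functional as Vector
open import Function using (_∘_; const)
open import Function.Definitions using (Injective)
open import Relation.Binary.Definitions using (Decidable; Symmetric; _Respects_)
import Relation.Binary.PropositionalEquality as ≡
open ≡ using (_≡_; _≢_; _≗_; refl; trans; cong; subst; subst₂)
open import Relation.Nullary using (¬_; Dec; yes; no; contradiction)
open import Relation.Nullary.Decidable using (map′; ¬?; _×-dec_; _⊎-dec_; _→-dec_)
import Relation.Unary as U

private
  variable
    k m : ℕ

-- Deciding the H-process

-- Without function extensionality, P must be transported from f to head f ∷ tail f by hand.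
anyFunction? : ∀ k {P : (Fin k → Fin m) → Set} → P Respects _≗_ → U.Decidable P → Dec (∃ P)
anyFunction? zero resp P? = map′ (none ,_) (λ (f , p) → resp (λ ()) p) (P? none)
  where
  none : Fin 0 → Fin _
  none ()
anyFunction? (suc k) resp P? =
  map′ (λ (c , g , p) → c Vector.∷ g , p)
       (λ (f , p) → Vector.head f , Vector.tail f , resp uncons p)
       (any? λ c → anyFunction? k (resp ∘ cons-cong c) (P? ∘ (c Vector.∷_)))
  where
  uncons : ∀ {f} → f ≗ Vector.head f Vector.∷ Vector.tail f
  uncons zero    = refl
  uncons (suc i) = refl
  cons-cong : ∀ c {f g} → f ≗ g → (c Vector.∷ f) ≗ (c Vector.∷ g)
  cons-cong c f≗g zero    = refl
  cons-cong c f≗g (suc i) = f≗g i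

injective? : (φ : Fin k → Fin m) → Dec (Injective _≡_ _≡_ φ)
injective? φ = map′ (λ inj {x} {y} → inj x y) (λ inj x y → inj)
  (all? λ x → all? λ y → (φ x ≟ φ y) →-dec (x ≟ y))

module _ (H : Graph) where

  isCopy-resp : {E : Rel m} → IsCopy H E Respects _≗_
  isCopy-resp {E = E} f≗g (inj , edges) =
    (λ {x} {y} gx≡gy → inj (trans (f≗g x) (trans gx≡gy (≡.sym (f≗g y))))) ,
    λ x y xy → subst₂ E (f≗g x) (f≗g y) (edges x y xy)

  isCopy-mono : {E E′ : Rel m} → (∀ {c d} → E c d → E′ c d) → ∀ {φ} → IsCopy H E φ → IsCopy H E′ φ
  isCopy-mono E⊆E′ (inj , edges) = inj , λ x y xy → E⊆E′ (edges x y xy)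

  addEdge? : {E : Rel m} → Decidable E → ∀ a b → Decidable (addEdge E a b)
  addEdge? E? a b c d = E? c d ⊎-dec (((c ≟ a) ×-dec (d ≟ b)) ⊎-dec ((c ≟ b) ×-dec (d ≟ a)))

  isCopy? : {E : Rel m} → Decidable E → U.Decidable (IsCopy H E)
  isCopy? E? φ = injective? φ ×-dec all? λ x → all? λ y → (adj H x y Bool.≟ true) →-dec E? (φ x) (φ y)

  moreCopies? : {E : Rel m} → Decidable E → Decidable (MoreCopies H E)
  moreCopies? {E = E} E? a b = anyFunction? (n H) resp
    (λ φ → isCopy? (addEdge? E? a b) φ ×-dec ¬? (isCopy? E? φ))
    where
    resp : (λ φ → IsCopy H (addEdge E a b) φ × ¬ IsCopy H E φ) Respects _≗_
    resp f≗g (copy , ¬copy) =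
      isCopy-resp {E = addEdge E a b} f≗g copy , ¬copy ∘ isCopy-resp {E = E} (≡.sym ∘ f≗g)

  step? : {E : Rel m} → Decidable E → Decidable (step H E)
  step? E? a b = E? a b ⊎-dec (¬? (a ≟ b) ×-dec (¬? (E? a b) ×-dec moreCopies? E? a b))

  addEdge-sym : {E : Rel m} → Symmetric E → ∀ {a b} → Symmetric (addEdge E a b)
  addEdge-sym E-sym (inj₁ e)                    = inj₁ (E-sym e)
  addEdge-sym E-sym (inj₂ (inj₁ (refl , refl))) = inj₂ (inj₂ (refl , refl))
  addEdge-sym E-sym (inj₂ (inj₂ (refl , refl))) = inj₂ (inj₁ (refl , refl))

  addEdge-swap : {E : Rel m} → ∀ {a b c d} → addEdge E a b c d → addEdge E b a c d
  addEdge-swap (inj₁ e)        = inj₁ e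
  addEdge-swap (inj₂ (inj₁ p)) = inj₂ (inj₂ p)
  addEdge-swap (inj₂ (inj₂ p)) = inj₂ (inj₁ p)

  moreCopies-swap : {E : Rel m} → ∀ {a b} → MoreCopies H E a b → MoreCopies H E b a
  moreCopies-swap {E = E} {a} {b} (φ , copy , ¬copy) =
    φ , isCopy-mono {E = addEdge E a b} {E′ = addEdge E b a} (addEdge-swap {E = E}) copy , ¬copy

  step-sym : {E : Rel m} → Symmetric E → Symmetric (step H E)
  step-sym E-sym (inj₁ e) = inj₁ (E-sym e)
  step-sym {E = E} E-sym (inj₂ (a≢b , ¬e , more)) =
    inj₂ (a≢b ∘ ≡.sym , ¬e ∘ E-sym , moreCopies-swap {E = E} more)

module _ (H G : Graph) where

  process? : ∀ i → Decidable (process H G i)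
  process? zero    a b = adj G a b Bool.≟ true
  process? (suc i)     = step? H (process? i)

  process-sym : ∀ i → Symmetric (process H G i)
  process-sym zero    {a} {b} ab = trans (Graph.sym G b a) ab
  process-sym (suc i)            = step-sym H (process-sym i)

  G⊆process : ∀ i {a b} → adj G a b ≡ true → process H G i a b
  G⊆process zero    ab = ab
  G⊆process (suc i) ab = inj₁ (G⊆process i ab)

  -- Stability alone only gives ¬ ¬ (a, b) ∈ G_t; deciding G_t removes the double negation.
  stable-closed : ∀ t {a b} → SameGraph (process H G t) (process H G (suc t)) → a ≢ b →
                  (¬ process H G t a b → MoreCopies H (process H G t) a b) → process H G t a b
  stable-closed t {a} {b} stable a≢b new with process? t a b
  ... | yes ab = ab
  ... | no ¬ab = proj₂ (stable a b) (inj₂ (a≢b , ¬ab , new ¬ab))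

0<∣p∣⇒Nonempty : {p : Subset k} → 0 < ∣ p ∣ → Nonempty p
0<∣p∣⇒Nonempty {k} {p} 0<∣p∣ with nonempty? p
... | yes nonempty = nonempty
... | no empty     = contradiction (subst (0 <_) ∣p∣≡0 0<∣p∣) λ ()
  where
  ∣p∣≡0 : ∣ p ∣ ≡ 0
  ∣p∣≡0 = trans (cong ∣_∣ (Empty-unique empty)) (∣⊥∣≡0 k)

∪-least : {p q r : Subset k} → p ⊆ r → q ⊆ r → p ∪ q ⊆ r
∪-least {p = p} {q} p⊆r q⊆r = [ p⊆r , q⊆r ]′ ∘ x∈p∪q⁻ p q

x∈p⇒⁅x⁆⊆p : ∀ {x} {p : Subset k} → x ∈ p → ⁅ x ⁆ ⊆ p
x∈p⇒⁅x⁆⊆p {x = x} {p} x∈p y∈⁅x⁆ = subst (_∈ p) (≡.sym (x∈⁅y⁆⇒x≡y x y∈⁅x⁆)) x∈p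

x∉p∧y∈⁅x⁆⇒y∉p : ∀ {x} {p : Subset k} → x ∉ p → ∀ {y} → y ∈ ⁅ x ⁆ → y ∉ p
x∉p∧y∈⁅x⁆⇒y∉p {x = x} {p} x∉p y∈⁅x⁆ = subst (_∉ p) (≡.sym (x∈⁅y⁆⇒x≡y x y∈⁅x⁆)) x∉p

x∈p∪q∧x∉p⇒x∈q : ∀ (p q : Subset k) {x} → x ∈ p ∪ q → x ∉ p → x ∈ q
x∈p∪q∧x∉p⇒x∈q p q x∈p∪q x∉p = [ (λ x∈p → contradiction x∈p x∉p) , (λ x∈q → x∈q) ]′ (x∈p∪q⁻ p q x∈p∪q)

x∈p∪q∧x∉q⇒x∈p : ∀ (p q : Subset k) {x} → x ∈ p ∪ q → x ∉ q → x ∈ p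
x∈p∪q∧x∉q⇒x∈p p q x∈p∪q x∉q = [ (λ x∈p → x∈p) , (λ x∈q → contradiction x∈q x∉q) ]′ (x∈p∪q⁻ p q x∈p∪q)

x∈p─q⇒x∉q : ∀ (p q : Subset k) {x} → x ∈ p ─ q → x ∉ q
x∈p─q⇒x∉q (s ∷ p) (inside ∷ q) ()            here
x∈p─q⇒x∉q (s ∷ p) (t ∷ q)      (there x∈p─q) (there x∈q) = x∈p─q⇒x∉q p q x∈p─q x∈q

∣p∪q∣≤∣p∣+∣q∣ : ∀ (p q : Subset k) → ∣ p ∪ q ∣ ≤ ∣ p ∣ + ∣ q ∣
∣p∪q∣≤∣p∣+∣q∣ []            []            = z≤n
∣p∪q∣≤∣p∣+∣q∣ (inside  ∷ p) (inside  ∷ q) =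
  s≤s (≤-trans (∣p∪q∣≤∣p∣+∣q∣ p q) (+-monoʳ-≤ ∣ p ∣ (m≤n⇒m≤1+n ≤-refl)))
∣p∪q∣≤∣p∣+∣q∣ (inside  ∷ p) (outside ∷ q) = s≤s (∣p∪q∣≤∣p∣+∣q∣ p q)
∣p∪q∣≤∣p∣+∣q∣ (outside ∷ p) (inside  ∷ q) =
  ≤-trans (s≤s (∣p∪q∣≤∣p∣+∣q∣ p q)) (≤-reflexive (≡.sym (+-suc ∣ p ∣ ∣ q ∣)))
∣p∪q∣≤∣p∣+∣q∣ (outside ∷ p) (outside ∷ q) = ∣p∪q∣≤∣p∣+∣q∣ p q

∣⁅x⁆∪p∣≤1+∣p∣ : ∀ (x : Fin k) p → ∣ ⁅ x ⁆ ∪ p ∣ ≤ suc ∣ p ∣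
∣⁅x⁆∪p∣≤1+∣p∣ x p = subst (λ s → ∣ ⁅ x ⁆ ∪ p ∣ ≤ s + ∣ p ∣) (∣⁅x⁆∣≡1 x) (∣p∪q∣≤∣p∣+∣q∣ ⁅ x ⁆ p)

∣p∣≤∣q∣+∣p─q∣ : ∀ (p q : Subset k) → ∣ p ∣ ≤ ∣ q ∣ + ∣ p ─ q ∣
∣p∣≤∣q∣+∣p─q∣ p q = ≤-trans (p⊆q⇒∣p∣≤∣q∣ p⊆q∪p─q) (∣p∪q∣≤∣p∣+∣q∣ q (p ─ q))
  where
  p⊆q∪p─q : p ⊆ q ∪ (p ─ q)
  p⊆q∪p─q {x} x∈p with x ∈? q
  ... | yes x∈q = x∈p∪q⁺ (inj₁ x∈q)
  ... | no  x∉q = x∈p∪q⁺ (inj₂ (x∈p∧x∉q⇒x∈p─q x∈p x∉q))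

∣p∣≤1+∣p-x∣ : ∀ (p : Subset k) x → ∣ p ∣ ≤ suc ∣ p - x ∣
∣p∣≤1+∣p-x∣ p x = subst (λ s → ∣ p ∣ ≤ s + ∣ p - x ∣) (∣⁅x⁆∣≡1 x) (∣p∣≤∣q∣+∣p─q∣ p ⁅ x ⁆)

∈-nbhd⁺ : ∀ {G u w} → adj G u w ≡ true → w ∈ nbhd G u
∈-nbhd⁺ {G} {u} {w} uw = lookup⇒[]= w (nbhd G u) (trans (lookup∘tabulate (adj G u) w) uw)

∈-nbhd⁻ : ∀ {G u w} → w ∈ nbhd G u → adj G u w ≡ true
∈-nbhd⁻ {G} {u} {w} w∈N[u] = trans (≡.sym (lookup∘tabulate (adj G u) w)) ([]=⇒lookup w∈N[u])

∉-nbhd-self : ∀ G u → u ∉ nbhd G u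
∉-nbhd-self G u u∈N[u] = Bool.not-¬ (∈-nbhd⁻ {G} u∈N[u]) (irrefl G u)

-- Injections between subsets

record Embeds (f : Fin k → Fin m) (D : Subset k) (B : Subset m) : Set where
  field
    mapsInto    : ∀ {z} → z ∈ D → f z ∈ B
    injectiveOn : ∀ {z w} → z ∈ D → w ∈ D → f z ≡ f w → z ≡ w
open Embeds

Embeds-skip : ∀ {f D} {I : Subset m} d → Embeds {k} f D I → Embeds (d Vector.∷ f) (outside ∷ D) I
mapsInto    (Embeds-skip d e) (there z∈D)             = mapsInto e z∈D
injectiveOn (Embeds-skip d e) (there z∈D) (there w∈D) = cong suc ∘ injectiveOn e z∈D w∈D

Embeds-cons : ∀ {f D} {I : Subset m} {c} → Embeds {k} f D I → c ∉ I →
              Embeds (c Vector.∷ f) (inside ∷ D) (⁅ c ⁆ ∪ I)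
mapsInto    (Embeds-cons {c = c} e c∉I) here        = x∈p∪q⁺ (inj₁ (x∈⁅x⁆ c))
mapsInto    (Embeds-cons e c∉I)         (there z∈D) = x∈p∪q⁺ (inj₂ (mapsInto e z∈D))
injectiveOn (Embeds-cons e c∉I) here        here        _    = refl
injectiveOn (Embeds-cons e c∉I) here        (there w∈D) c≡fw =
  contradiction (subst (_∈ _) (≡.sym c≡fw) (mapsInto e w∈D)) c∉I
injectiveOn (Embeds-cons e c∉I) (there z∈D) here        fz≡c =
  contradiction (subst (_∈ _) fz≡c (mapsInto e z∈D)) c∉I
injectiveOn (Embeds-cons e c∉I) (there z∈D) (there w∈D) fz≡fw = cong suc (injectiveOn e z∈D w∈D fz≡fw)

record Embedding (D : Subset k) (B : Subset m) : Set where
  field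
    fun         : Fin k → Fin m
    image       : Subset m
    image⊆B     : image ⊆ B
    ∣image∣≤∣D∣ : ∣ image ∣ ≤ ∣ D ∣
    embeds      : Embeds fun D image
open Embedding

-- Points outside D are sent to the junk value d.
embed : ∀ (D : Subset k) (B : Subset m) (d : Fin m) → ∣ D ∣ ≤ ∣ B ∣ → Embedding D B
embed {m = m} [] B d _ = record
  { fun = λ () ; image = ⊥ ; image⊆B = λ x∈⊥ → contradiction x∈⊥ ∉⊥
  ; ∣image∣≤∣D∣ = ≤-reflexive (∣⊥∣≡0 m) ; embeds = record { mapsInto = λ () ; injectiveOn = λ () } }
embed (outside ∷ D) B d ∣D∣≤∣B∣ = record
  { fun = d Vector.∷ fun e ; image = image e ; image⊆B = image⊆B e
  ; ∣image∣≤∣D∣ = ∣image∣≤∣D∣ e ; embeds = Embeds-skip d (embeds e) }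
  where
  e : Embedding D B
  e = embed D B d ∣D∣≤∣B∣
embed (inside ∷ D) B d ∣D∣<∣B∣ with 0<∣p∣⇒Nonempty (≤-trans (s≤s z≤n) ∣D∣<∣B∣)
... | c , c∈B = record
  { fun = c Vector.∷ fun e ; image = ⁅ c ⁆ ∪ image e
  ; image⊆B = ∪-least (x∈p⇒⁅x⁆⊆p c∈B) (p─q⊆p B ⁅ c ⁆ ∘ image⊆B e)
  ; ∣image∣≤∣D∣ = ≤-trans (∣⁅x⁆∪p∣≤1+∣p∣ c (image e)) (s≤s (∣image∣≤∣D∣ e))
  ; embeds = Embeds-cons (embeds e) (λ c∈I → x∈p─q⇒x∉q B ⁅ c ⁆ (image⊆B e c∈I) (x∈⁅x⁆ c)) }
  where
  e : Embedding D (B - c)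
  e = embed D (B - c) d (≤-pred (≤-trans ∣D∣<∣B∣ (∣p∣≤1+∣p-x∣ B c)))

choose : ∀ {A : Set} → Subset k → (Fin k → A) → (Fin k → A) → Fin k → A
choose D f g z with z ∈? D
... | yes _ = f z
... | no  _ = g z

choose-∈ : ∀ {A : Set} {D : Subset k} {f g : Fin k → A} {z} → z ∈ D → choose D f g z ≡ f z
choose-∈ {D = D} {z = z} z∈D with z ∈? D
... | yes _   = refl
... | no  z∉D = contradiction z∈D z∉D

choose-∉ : ∀ {A : Set} {D : Subset k} {f g : Fin k → A} {z} → z ∉ D → choose D f g z ≡ g z
choose-∉ {D = D} {z = z} z∉D with z ∈? D
... | yes z∈D = contradiction z∈D z∉D
... | no  _   = refl

Embeds-choose : ∀ {D E : Subset k} {B C : Subset m} {f g} → Embeds f D B → Embeds g E C →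
                (∀ {c} → c ∈ B → c ∉ C) → Embeds (choose D f g) (D ∪ E) (B ∪ C)
Embeds-choose {D = D} {E} {B} {C} {f} {g} eF eG B∩C=∅ = record { mapsInto = maps ; injectiveOn = inj }
  where
  ∈E : ∀ {z} → z ∈ D ∪ E → z ∉ D → z ∈ E
  ∈E = x∈p∪q∧x∉p⇒x∈q D E
  maps : ∀ {z} → z ∈ D ∪ E → choose D f g z ∈ B ∪ C
  maps {z} z∈D∪E with z ∈? D
  ... | yes z∈D = x∈p∪q⁺ (inj₁ (mapsInto eF z∈D))
  ... | no  z∉D = x∈p∪q⁺ (inj₂ (mapsInto eG (∈E z∈D∪E z∉D)))
  inj : ∀ {z w} → z ∈ D ∪ E → w ∈ D ∪ E → choose D f g z ≡ choose D f g w → z ≡ w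
  inj {z} {w} z∈ w∈ eq with z ∈? D | w ∈? D
  ... | yes z∈D | yes w∈D = injectiveOn eF z∈D w∈D eq
  ... | no  z∉D | no  w∉D = injectiveOn eG (∈E z∈ z∉D) (∈E w∈ w∉D) eq
  ... | yes z∈D | no  w∉D =
    contradiction (subst (_∈ C) (≡.sym eq) (mapsInto eG (∈E w∈ w∉D))) (B∩C=∅ (mapsInto eF z∈D))
  ... | no  z∉D | yes w∈D =
    contradiction (subst (_∈ C) eq (mapsInto eG (∈E z∈ z∉D))) (B∩C=∅ (mapsInto eF w∈D))

Embeds-⁅⁆ : ∀ (z : Fin k) (c : Fin m) → Embeds (const c) ⁅ z ⁆ ⁅ c ⁆
mapsInto    (Embeds-⁅⁆ z c) _           = x∈⁅x⁆ c
injectiveOn (Embeds-⁅⁆ z c) z₁∈⁅z⁆ z₂∈⁅z⁆ _ = trans (x∈⁅y⁆⇒x≡y z z₁∈⁅z⁆) (≡.sym (x∈⁅y⁆⇒x≡y z z₂∈⁅z⁆))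

-- For S the neighbourhood of x in H, K a clique of F and N ⊆ N_F(a), such a φ is a copy of H
-- in F + ab that uses the edge ab.
record IsStarEmbedding (φ : Fin k → Fin m) (S : Subset k) (x y : Fin k) (K N : Subset m) (a b : Fin m)
       : Set where
  field
    injective   : Injective _≡_ _≡_ φ
    centre      : φ x ≡ a
    leaf        : φ y ≡ b
    intoK       : ∀ {z} → z ≢ x → φ z ∈ K
    leavesIntoN : ∀ {z} → z ∈ S - y → φ z ∈ N

module _ {S : Subset k} {x y : Fin k} {K N : Subset m} {a b : Fin m}
         (x∉S : x ∉ S) (y∈S : y ∈ S) (a∉K : a ∉ K) (b∈K : b ∈ K) (b∉N : b ∉ N) (N⊆K : N ⊆ K)
         (∣S∣≤1+∣N∣ : ∣ S ∣ ≤ suc ∣ N ∣) (k≤1+∣K∣ : k ≤ suc ∣ K ∣) where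

  private
    leaves : Embedding (S - y) N
    leaves = embed (S - y) N a (≤-pred (≤-trans (x∈p⇒∣p-x∣<∣p∣ y∈S) ∣S∣≤1+∣N∣))

    used : Subset m
    used = ⁅ b ⁆ ∪ image leaves

    ∣used∣≤∣S∣ : ∣ used ∣ ≤ ∣ S ∣
    ∣used∣≤∣S∣ = ≤-trans (∣⁅x⁆∪p∣≤1+∣p∣ b (image leaves))
                        (≤-trans (s≤s (∣image∣≤∣D∣ leaves)) (x∈p⇒∣p-x∣<∣p∣ y∈S))

    ∣∁S-x∣≤∣K─used∣ : ∣ ∁ S - x ∣ ≤ ∣ K ─ used ∣
    ∣∁S-x∣≤∣K─used∣ = ≤-pred (+-cancelʳ-≤ ∣ S ∣ _ _ (begin
      suc ∣ ∁ S - x ∣ + ∣ S ∣        ≤⟨ +-monoˡ-≤ ∣ S ∣ ∣∁S-x∣<k∸∣S∣ ⟩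
      k ∸ ∣ S ∣ + ∣ S ∣              ≡⟨ m∸n+n≡m (∣p∣≤n S) ⟩
      k                             ≤⟨ k≤1+∣K∣ ⟩
      suc ∣ K ∣                     ≤⟨ s≤s (∣p∣≤∣q∣+∣p─q∣ K used) ⟩
      suc (∣ used ∣ + ∣ K ─ used ∣)  ≤⟨ s≤s (+-monoˡ-≤ ∣ K ─ used ∣ ∣used∣≤∣S∣) ⟩
      suc (∣ S ∣ + ∣ K ─ used ∣)     ≡⟨ cong suc (+-comm ∣ S ∣ ∣ K ─ used ∣) ⟩
      suc ∣ K ─ used ∣ + ∣ S ∣       ∎))
      where
      open ≤-Reasoning
      ∣∁S-x∣<k∸∣S∣ : ∣ ∁ S - x ∣ < k ∸ ∣ S ∣
      ∣∁S-x∣<k∸∣S∣ = subst (∣ ∁ S - x ∣ <_) (∣∁p∣≡n∸∣p∣ S) (x∈p⇒∣p-x∣<∣p∣ (x∉p⇒x∈∁p x∉S))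

    rest : Embedding (∁ S - x) (K ─ used)
    rest = embed (∁ S - x) (K ─ used) a ∣∁S-x∣≤∣K─used∣

    φ₁ φ : Fin k → Fin m
    φ₁ = choose ⁅ y ⁆ (const b) (choose (S - y) (fun leaves) (fun rest))
    φ  = choose ⁅ x ⁆ (const a) φ₁

    images : Subset m
    images = ⁅ b ⁆ ∪ (image leaves ∪ image rest)

    images⊆K : images ⊆ K
    images⊆K = ∪-least (x∈p⇒⁅x⁆⊆p b∈K) (∪-least (N⊆K ∘ image⊆B leaves) (p─q⊆p K used ∘ image⊆B rest))

    used∉rest : ∀ {c} → c ∈ used → c ∉ image rest
    used∉rest c∈used c∈rest = x∈p─q⇒x∉q K used (image⊆B rest c∈rest) c∈used

    φ₁-embeds : Embeds φ₁ (⁅ y ⁆ ∪ ((S - y) ∪ (∁ S - x))) images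
    φ₁-embeds = Embeds-choose (Embeds-⁅⁆ y b)
      (Embeds-choose (embeds leaves) (embeds rest) (used∉rest ∘ x∈p∪q⁺ ∘ inj₂))
      (x∉p∧y∈⁅x⁆⇒y∉p ([ b∉N ∘ image⊆B leaves , used∉rest (x∈p∪q⁺ (inj₁ (x∈⁅x⁆ b))) ]′ ∘ x∈p∪q⁻ _ _))

    φ-embeds : Embeds φ (⁅ x ⁆ ∪ (⁅ y ⁆ ∪ ((S - y) ∪ (∁ S - x)))) (⁅ a ⁆ ∪ images)
    φ-embeds = Embeds-choose (Embeds-⁅⁆ x a) φ₁-embeds (x∉p∧y∈⁅x⁆⇒y∉p (a∉K ∘ images⊆K))

    covers-non-centre : ∀ {z} → z ≢ x → z ∈ ⁅ y ⁆ ∪ ((S - y) ∪ (∁ S - x))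
    covers-non-centre {z} z≢x with z ≟ y | z ∈? S
    ... | yes refl | _       = x∈p∪q⁺ (inj₁ (x∈⁅x⁆ y))
    ... | no  z≢y  | yes z∈S = x∈p∪q⁺ (inj₂ (x∈p∪q⁺ (inj₁ (x∈p∧x≢y⇒x∈p-y z∈S z≢y))))
    ... | no  _    | no  z∉S = x∈p∪q⁺ (inj₂ (x∈p∪q⁺ (inj₂ (x∈p∧x≢y⇒x∈p-y (x∉p⇒x∈∁p z∉S) z≢x))))

    covers : ∀ z → z ∈ ⁅ x ⁆ ∪ (⁅ y ⁆ ∪ ((S - y) ∪ (∁ S - x)))
    covers z with z ≟ x
    ... | yes refl = x∈p∪q⁺ (inj₁ (x∈⁅x⁆ x))
    ... | no  z≢x  = x∈p∪q⁺ (inj₂ (covers-non-centre z≢x))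

    ∈S⇒∉⁅x⁆ : ∀ {z} → z ∈ S → z ∉ ⁅ x ⁆
    ∈S⇒∉⁅x⁆ z∈S = x≢y⇒x∉⁅y⁆ λ { refl → x∉S z∈S }

  starEmbedding : ∃ λ φ → IsStarEmbedding φ S x y K N a b
  starEmbedding = φ , record
    { injective   = injectiveOn φ-embeds (covers _) (covers _)
    ; centre      = choose-∈ (x∈⁅x⁆ x)
    ; leaf        = trans (choose-∉ (∈S⇒∉⁅x⁆ y∈S)) (choose-∈ (x∈⁅x⁆ y))
    ; intoK       = λ z≢x → subst (_∈ K) (≡.sym (choose-∉ (x≢y⇒x∉⁅y⁆ z≢x)))
                      (images⊆K (mapsInto φ₁-embeds (covers-non-centre z≢x)))
    ; leavesIntoN = λ z∈S-y → subst (_∈ N)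
                      (≡.sym (trans (choose-∉ (∈S⇒∉⁅x⁆ (p─q⊆p S ⁅ y ⁆ z∈S-y)))
                             (trans (choose-∉ (x∈p─q⇒x∉q S ⁅ y ⁆ z∈S-y)) (choose-∈ z∈S-y))))
                      (image⊆B leaves (mapsInto (embeds leaves) z∈S-y))
    }

module _ (H : Graph) {F : Rel m} (F-sym : Symmetric F) {K N : Subset m} {a b : Fin m}
         (K-clique : IsClique F K) (N⊆F[a] : ∀ {c} → c ∈ N → F a c)
         {x y : Fin (n H)} {φ : Fin (n H) → Fin m}
         (star : IsStarEmbedding φ (nbhd H x) x y K N a b) where
  open IsStarEmbedding star

  starEmbedding-isCopy : IsCopy H (addEdge F a b) φ
  starEmbedding-isCopy = injective , edge
    where
    spoke : ∀ {w} → adj H x w ≡ true → addEdge F a b (φ x) (φ w)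
    spoke {w} xw with w ≟ y
    ... | yes refl = subst₂ (addEdge F a b) (≡.sym centre) (≡.sym leaf) (inj₂ (inj₁ (refl , refl)))
    ... | no  w≢y  = subst (λ c → addEdge F a b c (φ w)) (≡.sym centre)
                       (inj₁ (N⊆F[a] (leavesIntoN (x∈p∧x≢y⇒x∈p-y (∈-nbhd⁺ {H} xw) w≢y))))
    edge : ∀ z w → adj H z w ≡ true → addEdge F a b (φ z) (φ w)
    edge z w zw with z ≟ x | w ≟ x
    ... | yes refl | yes refl = contradiction (irrefl H x) (Bool.not-¬ zw)
    ... | yes refl | no  _    = spoke zw
    ... | no  _    | yes refl = addEdge-sym H {E = F} F-sym {a} {b} (spoke (trans (Graph.sym H x z) zw))
    ... | no  z≢x  | no  w≢x  = inj₁ (K-clique _ _ (intoK z≢x) (intoK w≢x) (z≢w ∘ injective))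
      where
      z≢w : z ≢ w
      z≢w refl = Bool.not-¬ zw (irrefl H z)

  starEmbedding-usesEdge : adj H x y ≡ true → IsCopy H F φ → F a b
  starEmbedding-usesEdge xy (_ , edges) = subst₂ F centre leaf (edges x y xy)

δ≤degree : ∀ H x → δ H ≤ degree H x
δ≤degree H x = All.lookup (foldr-forcesᵇ (λ p q δ≤p⊓q → m≤n⊓o⇒m≤n p q δ≤p⊓q , m≤n⊓o⇒m≤o p q δ≤p⊓q)
                                          (n H) (map (degree H) (allFin (n H))) ≤-refl)
                          (∈-map⁺ (degree H) (∈-allFin x))

minimumDegreeVertex : ∀ H → 1 ≤ δ H → ∃ λ x → degree H x ≤ δ H
minimumDegreeVertex H 1≤δ with foldr-selective ⊓-sel (n H) (map (degree H) (allFin (n H)))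
... | inj₁ δ≡n = x , subst (degree H x ≤_) (≡.sym δ≡n) (∣p∣≤n (nbhd H x))
  where
  x : Fin (n H)
  x = fromℕ< (subst (1 ≤_) δ≡n 1≤δ)
... | inj₂ δ∈degrees with ∈-map⁻ (degree H) δ∈degrees
...   | x , _ , δ≡degree = x , ≤-reflexive (≡.sym δ≡degree)

-- Cliques in a stable stage of the process

IsClique-∪ : ∀ {F : Rel k} {U W} → Symmetric F → IsClique F W →
             (∀ {a b} → a ∈ U → a ∉ W → b ∈ W → F a b) →
             (∀ {a b} → a ∈ U → a ∉ W → b ∈ U → b ∉ W → a ≢ b → F a b) →
             IsClique F (U ∪ W)
IsClique-∪ {U = U} {W} F-sym W-clique U→W U→U a b a∈U∪W b∈U∪W a≢b with a ∈? W | b ∈? W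
... | yes a∈W | yes b∈W = W-clique a b a∈W b∈W a≢b
... | no  a∉W | yes b∈W = U→W (x∈p∪q∧x∉q⇒x∈p U W a∈U∪W a∉W) a∉W b∈W
... | yes a∈W | no  b∉W = F-sym (U→W (x∈p∪q∧x∉q⇒x∈p U W b∈U∪W b∉W) b∉W a∈W)
... | no  a∉W | no  b∉W = U→U (x∈p∪q∧x∉q⇒x∈p U W a∈U∪W a∉W) a∉W (x∈p∪q∧x∉q⇒x∈p U W b∈U∪W b∉W) b∉W a≢b

module _ (H G : Graph) (t : ℕ) (stable : SameGraph (process H G t) (process H G (suc t)))
         (1≤δ : 1 ≤ δ H) where
  private
    F : Rel (n G)
    F = process H G t

  joins-clique : ∀ {K N : Subset (n G)} {a b} → IsClique F K → v H ∸ 1 ≤ ∣ K ∣ → a ∉ K → b ∈ K →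
                 N ⊆ K → b ∉ N → (∀ {c} → c ∈ N → F a c) → δ H ∸ 1 ≤ ∣ N ∣ → F a b
  joins-clique K-clique ∣K∣≥ a∉K b∈K N⊆K b∉N N⊆F[a] ∣N∣≥
    with minimumDegreeVertex H 1≤δ
  ... | x , deg[x]≤δ with 0<∣p∣⇒Nonempty (≤-trans 1≤δ (δ≤degree H x))
  ... | y , y∈N[x] with starEmbedding (∉-nbhd-self H x) y∈N[x] a∉K b∈K b∉N N⊆K
                          (≤-trans deg[x]≤δ (≤-trans (m≤n+m∸n (δ H) 1) (s≤s ∣N∣≥)))
                          (≤-trans (m≤n+m∸n (v H) 1) (s≤s ∣K∣≥))
  ... | φ , star = stable-closed H G t stable (λ { refl → a∉K b∈K }) λ ¬ab →
    φ , starEmbedding-isCopy H (process-sym H G t) K-clique N⊆F[a] star ,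
    ¬ab ∘ starEmbedding-usesEdge H (process-sym H G t) K-clique N⊆F[a] star (∈-nbhd⁻ {H} y∈N[x])

  neighbours-join-clique : ∀ {W a b} → IsClique F W → v H ∸ 1 ≤ ∣ W ∣ → a ∉ W →
                           δ H ∸ 1 ≤ ∣ W ∩ nbhd G a ∣ → b ∈ W → F a b
  neighbours-join-clique {W} {a} {b} W-clique ∣W∣≥ a∉W ∣N∣≥ b∈W with adj G a b in ab
  ... | true  = G⊆process H G t ab
  ... | false = joins-clique W-clique ∣W∣≥ a∉W b∈W (proj₁ ∘ x∈p∩q⁻ W _)
    (λ b∈N → Bool.not-¬ (∈-nbhd⁻ {G} (proj₂ (x∈p∩q⁻ W _ b∈N))) ab)
    (λ c∈N → G⊆process H G t (∈-nbhd⁻ {G} (proj₂ (x∈p∩q⁻ W _ c∈N))))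
    ∣N∣≥

  two-join-clique : ∀ {W a b} → IsClique F W → v H ∸ 1 ≤ ∣ W ∣ →
                    a ∉ W → δ H ∸ 1 ≤ ∣ W ∩ nbhd G a ∣ → b ∉ W → δ H ∸ 1 ≤ ∣ W ∩ nbhd G b ∣ →
                    a ≢ b → F a b
  two-join-clique {W} {a} {b} W-clique ∣W∣≥ a∉W ∣N[a]∣≥ b∉W ∣N[b]∣≥ a≢b =
    joins-clique {K = ⁅ b ⁆ ∪ W} K-clique (≤-trans ∣W∣≥ (∣q∣≤∣p∪q∣ ⁅ b ⁆ W)) a∉K
      (x∈p∪q⁺ (inj₁ (x∈⁅x⁆ b))) (x∈p∪q⁺ ∘ inj₂) b∉W
      (neighbours-join-clique W-clique ∣W∣≥ a∉W ∣N[a]∣≥) (≤-trans ∣N[a]∣≥ (∣p∩q∣≤∣p∣ W _))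
    where
    K-clique : IsClique F (⁅ b ⁆ ∪ W)
    K-clique = IsClique-∪ (process-sym H G t) W-clique
      (λ c∈⁅b⁆ _ d∈W → subst (λ c → F c _) (≡.sym (x∈⁅y⁆⇒x≡y b c∈⁅b⁆))
                         (neighbours-join-clique W-clique ∣W∣≥ b∉W ∣N[b]∣≥ d∈W))
      (λ c∈⁅b⁆ _ d∈⁅b⁆ _ c≢d → contradiction (trans (x∈⁅y⁆⇒x≡y b c∈⁅b⁆) (≡.sym (x∈⁅y⁆⇒x≡y b d∈⁅b⁆))) c≢d)
    a∉K : a ∉ ⁅ b ⁆ ∪ W
    a∉K = [ a≢b ∘ x∈⁅y⁆⇒x≡y b , a∉W ]′ ∘ x∈p∪q⁻ ⁅ b ⁆ W

lemma4p6 : (H G : Graph) (U W : Subset (n G)) →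
           1 ≤ δ H →
           (t : ℕ) → IsFinalTime H G t →
           IsClique (process H G t) W → v H ∸ 1 ≤ ∣ W ∣ →
           (∀ u → u ∈ U → δ H ∸ 1 ≤ ∣ W ∩ nbhd G u ∣) →
           IsClique (process H G t) (U ∪ W)
lemma4p6 H G U W 1≤δ t (stable , _) W-clique ∣W∣≥ U-degrees =
  IsClique-∪ (process-sym H G t) W-clique
    (λ a∈U a∉W → neighbours-join-clique H G t stable 1≤δ W-clique ∣W∣≥ a∉W (U-degrees _ a∈U))
    (λ a∈U a∉W b∈U b∉W →
       two-join-clique H G t stable 1≤δ W-clique ∣W∣≥ a∉W (U-degrees _ a∈U) b∉W (U-degrees _ b∈U))
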